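{- Let $V_2\subset\mathbb{A}^5$ be the threefold with coordinates $(b,x,y,u,v)$ defined by the equations $x^2+y^2=u+bv$ and $u^2+v^2=x+by$. Let $P=(b_0,x_0,y_0,u_0,v_0)$ be any point of $V_2$ with non-negative rational coordinates which does not lie on the lines $\{(t,0,0,0,0)\}$ and $\{(t,1,0,1,0)\}$. Then there exist two lines in $\mathbb{A}^5$, defined by equations with coefficients in $\mathbb{Q}$, which are entirely contained in $V_2$ and pass through $P$. -}

module Defs where

open import Data.Rational using (ℚ; 0ℚ; 1ℚ; _+_; _*_; _≤_)
open import Data.Product using (_×_; ∃)
open import Relation.Binary.PropositionalEquality using (_≡_)
open import Relation.Nullary using (¬_)

record Pt : Set where
  constructor pt
  field
    b x y u v : ℚ
open Pt public

InV₂ : Pt → Set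
InV₂ p = (x p * x p + y p * y p ≡ u p + b p * v p)
       × (u p * u p + v p * v p ≡ x p + b p * y p)

NonNeg : Pt → Set
NonNeg p = (0ℚ ≤ b p) × (0ℚ ≤ x p) × (0ℚ ≤ y p) × (0ℚ ≤ u p) × (0ℚ ≤ v p)

OnLine₀ : Pt → Set
OnLine₀ p = (x p ≡ 0ℚ) × (y p ≡ 0ℚ) × (u p ≡ 0ℚ) × (v p ≡ 0ℚ)

OnLine₁ : Pt → Set
OnLine₁ p = (x p ≡ 1ℚ) × (y p ≡ 0ℚ) × (u p ≡ 1ℚ) × (v p ≡ 0ℚ)

_+[_]•_ : Pt → ℚ → Pt → Pt
p +[ t ]• d = pt (b p + t * b d) (x p + t * x d) (y p + t * y d)
                 (u p + t * u d) (v p + t * v d)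

_•_ : ℚ → Pt → Pt
c • d = pt (c * b d) (c * x d) (c * y d) (c * u d) (c * v d)

zeroPt : Pt
zeroPt = pt 0ℚ 0ℚ 0ℚ 0ℚ 0ℚ

-- The rational line through p with direction d (d ≠ 0) lies in V₂.
-- (ℚ is infinite, so containment of all rational points of the line is the
-- same as containment of the line as a variety.)
LineInV₂ : Pt → Pt → Set
LineInV₂ p d = ¬ (d ≡ zeroPt) × (∀ (t : ℚ) → InV₂ (p +[ t ]• d))

Parallel : Pt → Pt → Set
Parallel d e = ∃ λ (c : ℚ) → e ≡ c • d

{-# OPTIONS --safe #-}
-- A rational line P + t d lies on V₂ iff d satisfies the two tangency conditions
-- dF₁ = dF₂ = 0 at P and lies on the cone F₁ʰ = F₂ʰ = 0 of leading forms.  The directions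
-- dir s (G , H , J) make the two leading forms agree identically, and for the slope
-- s = (x - u) / (b + y + v) (defined since P is nonnegative and off the two lines) the two
-- tangency conditions reduce to one linear condition n · (G , H , J) = 0.  So the lines
-- through P correspond to the points where the line n · g = 0 meets the conic Q s g = 0.
-- The discriminant of this intersection, -Φ s n, turns out to be the square (3 s² - 1)²,
-- which is nonzero because √3 is irrational: the two intersection points are rational and
-- distinct.
module Submission where

open import Defs
open import Algebra.Properties.Group using (x∙y⁻¹≈ε⇒x≈y; x≈y⇒x∙y⁻¹≈ε)
open import Data.Empty using (⊥; ⊥-elim)
open import Data.Integer as ℤ using (+_; ∣_∣; 1ℤ)
import Data.Integer.Properties as ℤ
open import Data.Maybe using (Maybe; just; nothing)
open import Data.Nat as ℕ using (ℕ; suc; z≤n; s≤s)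
import Data.Nat.Properties as ℕ
open import Data.Nat.Coprimality using (Coprime; coprime-divisor; recompute)
import Data.Nat.Coprimality as Coprime
open import Data.Nat.Divisibility using (_∣_; divides; ∣-refl)
open import Data.Product using (_×_; ∃₂; _,_; proj₁; proj₂)
open import Data.Rational as ℚ
  using (ℚ; mkℚ; 0ℚ; 1ℚ; _≤_; *≤*; 1/_; NonZero; ≢-nonZero; nonNegative; nonPositive)
open import Data.Rational.Literals using (fromℤ)
open import Data.Rational.Properties
  using (_≟_; +-0-group; +-*-commutativeRing; ≤-antisym; ≤-trans; ≤-reflexive; ≤-total;
         +-mono-≤; +-monoˡ-≤; +-monoʳ-≤; +-identityˡ; +-identityʳ;
         *-zeroʳ; *-identityˡ; *-identityʳ; *-assoc; *-inverseˡ;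
         nonNegative⁻¹; nonNeg*nonNeg⇒nonNeg; nonPos*nonPos⇒nonPos; toℚᵘ-homo-*; toℚᵘ-cong)
import Data.Rational.Unnormalised as ℚᵘ
import Data.Rational.Unnormalised.Properties as ℚᵘ
open import Data.Sum using (_⊎_; inj₁; inj₂; [_,_]′)
open import Function using (id; _∘_)
open import Level using (0ℓ)
open import Relation.Binary.PropositionalEquality
open import Relation.Nullary using (¬_; yes; no)
open import Tactic.RingSolver.Core.AlmostCommutativeRing
  using (AlmostCommutativeRing; fromCommutativeRing)

ring : AlmostCommutativeRing 0ℓ 0ℓ
ring = fromCommutativeRing +-*-commutativeRing is-zero
  where
  is-zero : ∀ (p : ℚ) → Maybe (0ℚ ≡ p)
  is-zero p with p ≟ 0ℚ
  ... | yes p≡0 = just (sym p≡0)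
  ... | no _    = nothing

open import Tactic.RingSolver.NonReflective ring using (solve; _⊜_)
import Tactic.RingSolver.NonReflective ring as Solver

-- Every polynomial below is written once over an Arithmetic R: at R = ℚ it states
-- the mathematics, at R = Expr it is the input of the ring solver.
record Arithmetic (R : Set) : Set where
  infixl 6 _+_
  infixl 7 _*_
  infix 8 -_
  field
    _+_ _*_ : R → R → R
    -_      : R → R
    numeral : ℕ → R

open Arithmetic {{...}} public

instance
  ℚ-arithmetic : Arithmetic ℚ
  ℚ-arithmetic = record { _+_ = ℚ._+_ ; _*_ = ℚ._*_ ; -_ = ℚ.-_ ; numeral = λ n → fromℤ (+ n) }

  Expr-arithmetic : ∀ {n} → Arithmetic (Solver.Expr (AlmostCommutativeRing.Carrier ring) n)
  Expr-arithmetic = record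
    { _+_ = Solver._⊕_ ; _*_ = Solver._⊗_ ; -_ = Solver.⊝_
    ; numeral = λ n → Solver.Κ (fromℤ (+ n)) }

infix 10 _³ _⁵

_³ _⁵ : Set → Set
A ³ = A × A × A
A ⁵ = A × A × A × A × A

module _ {R : Set} {{_ : Arithmetic R}} where

  infixl 6 _-_

  _-_ : R → R → R
  a - c = a + - c

  0# 1# 2# 3# 8# : R
  0# = numeral 0
  1# = numeral 1
  2# = numeral 2
  3# = numeral 3
  8# = numeral 8

private
  variable
    p q : ℚ

p≡q⇒p-q≡0 : p ≡ q → p - q ≡ 0ℚ
p≡q⇒p-q≡0 = x≈y⇒x∙y⁻¹≈ε +-0-group

p-q≡0⇒p≡q : p - q ≡ 0ℚ → p ≡ q
p-q≡0⇒p≡q = x∙y⁻¹≈ε⇒x≈y +-0-group _ _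

infixl 6 _+⁰_

_+⁰_ : p ≡ 0ℚ → q ≡ 0ℚ → p + q ≡ 0ℚ
refl +⁰ refl = refl

*⁰ : ∀ (a : ℚ) → p ≡ 0ℚ → a * p ≡ 0ℚ
*⁰ a refl = *-zeroʳ a

zero-product : ∀ (p q : ℚ) → p * q ≡ 0ℚ → p ≡ 0ℚ ⊎ q ≡ 0ℚ
zero-product p q pq≡0 with p ≟ 0ℚ
... | yes p≡0 = inj₁ p≡0
... | no p≢0 = inj₂ (begin
  q                ≡⟨ *-identityˡ q ⟨
  1ℚ * q           ≡⟨ cong (_* q) (*-inverseˡ p) ⟨
  1/ p * p * q     ≡⟨ *-assoc (1/ p) p q ⟩
  1/ p * (p * q)   ≡⟨ *⁰ (1/ p) pq≡0 ⟩
  0ℚ               ∎)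
  where
  open ≡-Reasoning
  instance
    p-nonZero : NonZero p
    p-nonZero = ≢-nonZero p≢0

*-nonZero : p ≢ 0ℚ → q ≢ 0ℚ → p * q ≢ 0ℚ
*-nonZero {p} {q} p≢0 q≢0 pq≡0 = [ p≢0 , q≢0 ]′ (zero-product p q pq≡0)

square-zero : p * p ≡ 0ℚ → p ≡ 0ℚ
square-zero {p} p²≡0 = [ id , id ]′ (zero-product p p p²≡0)

+-nonNeg : 0ℚ ≤ p → 0ℚ ≤ q → 0ℚ ≤ p + q
+-nonNeg = +-mono-≤

*-nonNeg : 0ℚ ≤ p → 0ℚ ≤ q → 0ℚ ≤ p * q
*-nonNeg {p} {q} 0≤p 0≤q =
  nonNegative⁻¹ (p * q) {{nonNeg*nonNeg⇒nonNeg p {{nonNegative 0≤p}} q {{nonNegative 0≤q}}}}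

square-nonNeg : ∀ (p : ℚ) → 0ℚ ≤ p * p
square-nonNeg p with ≤-total 0ℚ p
... | inj₁ 0≤p = *-nonNeg 0≤p 0≤p
... | inj₂ p≤0 =
  nonNegative⁻¹ (p * p) {{nonPos*nonPos⇒nonPos p {{nonPositive p≤0}} p {{nonPositive p≤0}}}}

nonNeg+nonNeg≡0 : 0ℚ ≤ p → 0ℚ ≤ q → p + q ≡ 0ℚ → p ≡ 0ℚ × q ≡ 0ℚ
nonNeg+nonNeg≡0 {p} {q} 0≤p 0≤q p+q≡0 = ≤-antisym p≤0 0≤p , ≤-antisym q≤0 0≤q
  where
  p≤0 : p ≤ 0ℚ
  p≤0 = ≤-trans (≤-reflexive (sym (+-identityʳ p))) (≤-trans (+-monoʳ-≤ p 0≤q) (≤-reflexive p+q≡0))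
  q≤0 : q ≤ 0ℚ
  q≤0 = ≤-trans (≤-reflexive (sym (+-identityˡ q))) (≤-trans (+-monoˡ-≤ q 0≤p) (≤-reflexive p+q≡0))

nonNeg+1≢0 : 0ℚ ≤ p → p + 1ℚ ≢ 0ℚ
nonNeg+1≢0 0≤p p+1≡0 with ≤-trans (+-monoˡ-≤ 1ℚ 0≤p) (≤-reflexive p+1≡0)
... | *≤* (ℤ.+≤+ ())

0≤3 : 0ℚ ≤ 3#
0≤3 = nonNegative⁻¹ 3#

m²≡jk²⇒k≡1 : ∀ {m k j} → Coprime m (suc k) → m ℕ.* m ≡ j ℕ.* (suc k ℕ.* suc k) → suc k ≡ 1
m²≡jk²⇒k≡1 {m} {k} {j} coprime eq = coprime (k∣m , ∣-refl)
  where
  k∣m : suc k ∣ m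
  k∣m = coprime-divisor (Coprime.sym coprime)
          (divides (j ℕ.* suc k) (trans eq (sym (ℕ.*-assoc j (suc k) (suc k)))))

3-not-square : ∀ m → m ℕ.* m ≢ 3
3-not-square 0 ()
3-not-square 1 ()
3-not-square (suc (suc m)) eq = ℕ.<-irrefl refl (ℕ.≤-trans 4≤m² (ℕ.≤-reflexive eq))
  where
  4≤m² : 4 ℕ.≤ suc (suc m) ℕ.* suc (suc m)
  4≤m² = ℕ.*-mono-≤ (s≤s (s≤s (z≤n {m}))) (s≤s (s≤s (z≤n {m})))

√3∉ℚ : ∀ (q : ℚ) → q * q ≢ 3#
√3∉ℚ q@(mkℚ n k coprime) q²≡3 = 3-not-square ∣ n ∣ ∣n∣²≡3
  where
  ∣n∣²≡3k² : ∣ n ∣ ℕ.* ∣ n ∣ ≡ 3 ℕ.* (suc k ℕ.* suc k)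
  ∣n∣²≡3k² with ℚᵘ.≃-trans (ℚᵘ.≃-sym (toℚᵘ-homo-* q q)) (toℚᵘ-cong q²≡3)
  ... | ℚᵘ.*≡* eq = begin
    ∣ n ∣ ℕ.* ∣ n ∣                      ≡⟨ ℕ.*-identityʳ _ ⟨
    ∣ n ∣ ℕ.* ∣ n ∣ ℕ.* 1                ≡⟨ cong (ℕ._* 1) (ℤ.abs-* n n) ⟨
    ∣ n ℤ.* n ∣ ℕ.* 1                    ≡⟨ ℤ.abs-* (n ℤ.* n) 1ℤ ⟨
    ∣ n ℤ.* n ℤ.* 1ℤ ∣                   ≡⟨ cong ∣_∣ eq ⟩
    ∣ + 3 ℤ.* + (suc k ℕ.* suc k) ∣      ≡⟨ ℤ.abs-* (+ 3) (+ (suc k ℕ.* suc k)) ⟩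
    3 ℕ.* (suc k ℕ.* suc k)              ∎
    where open ≡-Reasoning
  ∣n∣²≡3 : ∣ n ∣ ℕ.* ∣ n ∣ ≡ 3
  ∣n∣²≡3 = subst (λ d → ∣ n ∣ ℕ.* ∣ n ∣ ≡ 3 ℕ.* (d ℕ.* d))
                 (m²≡jk²⇒k≡1 {j = 3} (recompute coprime) ∣n∣²≡3k²) ∣n∣²≡3k²

-- Lines on V₂

module _ {R : Set} {{_ : Arithmetic R}} where

  F₁ F₂ F₁ʰ F₂ʰ : R ⁵ → R
  F₁ (b , x , y , u , v) = x * x + y * y - (u + b * v)
  F₂ (b , x , y , u , v) = u * u + v * v - (x + b * y)
  F₁ʰ (β , ξ , η , μ , ν) = ξ * ξ + η * η - β * ν
  F₂ʰ (β , ξ , η , μ , ν) = μ * μ + ν * ν - β * η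

  dF₁ dF₂ : R ⁵ → R ⁵ → R
  dF₁ (b , x , y , u , v) (β , ξ , η , μ , ν) = 2# * (x * ξ + y * η) - (μ + b * ν + β * v)
  dF₂ (b , x , y , u , v) (β , ξ , η , μ , ν) = 2# * (u * μ + v * ν) - (ξ + b * η + β * y)

⌊_⌋ : Pt → ℚ ⁵
⌊ p ⌋ = (b p , x p , y p , u p , v p)

⌈_⌉ : ℚ ⁵ → Pt
⌈ β , ξ , η , μ , ν ⌉ = pt β ξ η μ ν

F₁-along-line : ∀ (p d : Pt) (t : ℚ) →
  F₁ ⌊ p +[ t ]• d ⌋ ≡ F₁ ⌊ p ⌋ + t * dF₁ ⌊ p ⌋ ⌊ d ⌋ + t * t * F₁ʰ ⌊ d ⌋
F₁-along-line p d t = solve 11 (λ b x y u v β ξ η μ ν t →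
  F₁ (b + t * β , x + t * ξ , y + t * η , u + t * μ , v + t * ν)
    ⊜ (F₁ (b , x , y , u , v) + t * dF₁ (b , x , y , u , v) (β , ξ , η , μ , ν)
       + t * t * F₁ʰ (β , ξ , η , μ , ν)))
  refl (b p) (x p) (y p) (u p) (v p) (b d) (x d) (y d) (u d) (v d) t

F₂-along-line : ∀ (p d : Pt) (t : ℚ) →
  F₂ ⌊ p +[ t ]• d ⌋ ≡ F₂ ⌊ p ⌋ + t * dF₂ ⌊ p ⌋ ⌊ d ⌋ + t * t * F₂ʰ ⌊ d ⌋
F₂-along-line p d t = solve 11 (λ b x y u v β ξ η μ ν t →
  F₂ (b + t * β , x + t * ξ , y + t * η , u + t * μ , v + t * ν)
    ⊜ (F₂ (b , x , y , u , v) + t * dF₂ (b , x , y , u , v) (β , ξ , η , μ , ν)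
       + t * t * F₂ʰ (β , ξ , η , μ , ν)))
  refl (b p) (x p) (y p) (u p) (v p) (b d) (x d) (y d) (u d) (v d) t

InV₂⇒F≡0 : ∀ (p : Pt) → InV₂ p → F₁ ⌊ p ⌋ ≡ 0ℚ × F₂ ⌊ p ⌋ ≡ 0ℚ
InV₂⇒F≡0 p (e₁ , e₂) = p≡q⇒p-q≡0 e₁ , p≡q⇒p-q≡0 e₂

F≡0⇒InV₂ : ∀ (p : Pt) → F₁ ⌊ p ⌋ ≡ 0ℚ → F₂ ⌊ p ⌋ ≡ 0ℚ → InV₂ p
F≡0⇒InV₂ p f₁ f₂ = p-q≡0⇒p≡q f₁ , p-q≡0⇒p≡q f₂

line⊆V₂ : ∀ (p d : Pt) → InV₂ p →
  dF₁ ⌊ p ⌋ ⌊ d ⌋ ≡ 0ℚ → dF₂ ⌊ p ⌋ ⌊ d ⌋ ≡ 0ℚ → F₁ʰ ⌊ d ⌋ ≡ 0ℚ → F₂ʰ ⌊ d ⌋ ≡ 0ℚ →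
  ∀ t → InV₂ (p +[ t ]• d)
line⊆V₂ p d p∈V₂ d₁ d₂ h₁ h₂ t = F≡0⇒InV₂ (p +[ t ]• d)
  (trans (F₁-along-line p d t) (proj₁ f +⁰ *⁰ t d₁ +⁰ *⁰ (t * t) h₁))
  (trans (F₂-along-line p d t) (proj₂ f +⁰ *⁰ t d₂ +⁰ *⁰ (t * t) h₂))
  where
  f : F₁ ⌊ p ⌋ ≡ 0ℚ × F₂ ⌊ p ⌋ ≡ 0ℚ
  f = InV₂⇒F≡0 p p∈V₂

-- A family of directions on the cone F₁ʰ = F₂ʰ = 0

module _ {R : Set} {{_ : Arithmetic R}} where

  infixl 6 _⊕_
  infixl 7 _⋆_
  infix 7 _·_

  _⊕_ : R ³ → R ³ → R ³
  (a₁ , a₂ , a₃) ⊕ (c₁ , c₂ , c₃) = (a₁ + c₁ , a₂ + c₂ , a₃ + c₃)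

  _⋆_ : R → R ³ → R ³
  c ⋆ (a₁ , a₂ , a₃) = (c * a₁ , c * a₂ , c * a₃)

  _·_ : R ³ → R ³ → R
  (a₁ , a₂ , a₃) · (c₁ , c₂ , c₃) = a₁ * c₁ + a₂ * c₂ + a₃ * c₃

  -- F₁ʰ - F₂ʰ = (ξ - μ)(ξ + μ) - (ν - η)(ν + η + β), and on dir s (G , H , J) both
  -- products equal 4 s G H.
  dir : R → R ³ → R ⁵
  dir s (G , H , J) = (2# * (H - J) , G + s * H , J - s * G , G - s * H , J + s * G)

  Q : R → R ³ → R
  Q s (G , H , J) = (1# + s * s) * G * G + s * s * H * H - 2# * J * H + 3# * J * J

  Δ₁ Δ₂ : R ⁵ → R → R
  Δ₁ (b , x , y , u , v) s = s * (b + y + v) - (x - u)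
  Δ₂ (b , x , y , u , v) s = s * (x + u + 1#) - (v - y)

  normal : R ⁵ → R → R ³
  normal (b , x , y , u , v) s =
    (2# * x - 2# * s * y - 1# - s * b , 2# * s * x + s - 2# * v , 2# * y + 2# * v - b)

F₁ʰ-dir : ∀ (s : ℚ) (g : ℚ ³) → F₁ʰ (dir s g) ≡ Q s g
F₁ʰ-dir s (G , H , J) = solve 4 (λ s G H J → F₁ʰ (dir s (G , H , J)) ⊜ Q s (G , H , J)) refl s G H J

F₂ʰ-dir : ∀ (s : ℚ) (g : ℚ ³) → F₂ʰ (dir s g) ≡ Q s g
F₂ʰ-dir s (G , H , J) = solve 4 (λ s G H J → F₂ʰ (dir s (G , H , J)) ⊜ Q s (G , H , J)) refl s G H J

dF₁-dir : ∀ (p : Pt) (s : ℚ) (g : ℚ ³) → dF₁ ⌊ p ⌋ (dir s g) ≡ normal ⌊ p ⌋ s · g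
dF₁-dir p s (G , H , J) = solve 9 (λ b x y u v s G H J →
  dF₁ (b , x , y , u , v) (dir s (G , H , J)) ⊜ normal (b , x , y , u , v) s · (G , H , J))
  refl (b p) (x p) (y p) (u p) (v p) s G H J

dF₂-dir : ∀ (p : Pt) (s : ℚ) (g : ℚ ³) → let (G , H , J) = g in
  dF₂ ⌊ p ⌋ (dir s g) ≡ normal ⌊ p ⌋ s · g + 2# * G * Δ₁ ⌊ p ⌋ s + - 2# * H * Δ₂ ⌊ p ⌋ s
dF₂-dir p s (G , H , J) = solve 9 (λ b x y u v s G H J →
  dF₂ (b , x , y , u , v) (dir s (G , H , J))
    ⊜ (normal (b , x , y , u , v) s · (G , H , J)
       + 2# * G * Δ₁ (b , x , y , u , v) s + - 2# * H * Δ₂ (b , x , y , u , v) s))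
  refl (b p) (x p) (y p) (u p) (v p) s G H J

dir-line⊆V₂ : ∀ (p : Pt) (s : ℚ) (g : ℚ ³) → InV₂ p → Δ₁ ⌊ p ⌋ s ≡ 0ℚ → Δ₂ ⌊ p ⌋ s ≡ 0ℚ →
  normal ⌊ p ⌋ s · g ≡ 0ℚ → Q s g ≡ 0ℚ → ∀ t → InV₂ (p +[ t ]• ⌈ dir s g ⌉)
dir-line⊆V₂ p s (G , H , J) p∈V₂ δ₁ δ₂ n·g≡0 Qg≡0 = line⊆V₂ p ⌈ dir s (G , H , J) ⌉ p∈V₂
  (trans (dF₁-dir p s (G , H , J)) n·g≡0)
  (trans (dF₂-dir p s (G , H , J)) (n·g≡0 +⁰ *⁰ (2# * G) δ₁ +⁰ *⁰ (- 2# * H) δ₂))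
  (trans (F₁ʰ-dir s (G , H , J)) Qg≡0)
  (trans (F₂ʰ-dir s (G , H , J)) Qg≡0)

-- Where a line of the plane meets the conic Q s = 0

module _ {R : Set} {{_ : Arithmetic R}} where

  κ : R → R
  κ s = 3# * s * s - 1#

  -- Φ s is the adjugate form of Q s: Φ s n = 0 iff the line n · g = 0 touches Q s g = 0.
  Φ : R → R ³ → R
  Φ s (n₁ , n₂ , n₃) =
    κ s * n₁ * n₁ + (1# + s * s) * (3# * n₂ * n₂ + 2# * n₂ * n₃ + s * s * n₃ * n₃)

  base : R ³ → R ³
  base (n₁ , n₂ , n₃) = (- n₃ , 0# , n₁)

  -- The point of the line n · g = 0 that is Q s-conjugate to base n.
  conjugate : R → R ³ → R ³
  conjugate s (n₁ , n₂ , n₃) =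
    ( 3# * n₁ * n₂ + n₁ * n₃
    , - ((1# + s * s) * n₃ * n₃ + 3# * n₁ * n₁)
    , (1# + s * s) * n₂ * n₃ - n₁ * n₁ )

  pencil : R → R ³ → R → R → R ³
  pencil s n r σ = r ⋆ base n ⊕ σ ⋆ conjugate s n

pencil-on-line : ∀ (s : ℚ) (n : ℚ ³) (r σ : ℚ) → n · pencil s n r σ ≡ 0ℚ
pencil-on-line s (n₁ , n₂ , n₃) r σ = solve 6 (λ s n₁ n₂ n₃ r σ →
  (n₁ , n₂ , n₃) · pencil s (n₁ , n₂ , n₃) r σ ⊜ 0#) refl s n₁ n₂ n₃ r σ

Q-pencil : ∀ (s : ℚ) (n : ℚ ³) (r σ : ℚ) →
  Q s (pencil s n r σ) ≡ Q s (base n) * (r * r + Φ s n) + Q s (base n) * Φ s n * (σ * σ - 1#)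
Q-pencil s (n₁ , n₂ , n₃) r σ = solve 6 (λ s n₁ n₂ n₃ r σ →
  Q s (pencil s (n₁ , n₂ , n₃) r σ)
    ⊜ (Q s (base (n₁ , n₂ , n₃)) * (r * r + Φ s (n₁ , n₂ , n₃))
       + Q s (base (n₁ , n₂ , n₃)) * Φ s (n₁ , n₂ , n₃) * (σ * σ - 1#))) refl s n₁ n₂ n₃ r σ

pencil-on-conic : ∀ (s : ℚ) (n : ℚ ³) (r σ : ℚ) →
  r * r + Φ s n ≡ 0ℚ → σ * σ ≡ 1ℚ → Q s (pencil s n r σ) ≡ 0ℚ
pencil-on-conic s n r σ disc σ²≡1 = trans (Q-pencil s n r σ)
  (*⁰ (Q s (base n)) disc +⁰ *⁰ (Q s (base n) * Φ s n) (p≡q⇒p-q≡0 σ²≡1))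

Q-base : ∀ (s : ℚ) (n : ℚ ³) → let (n₁ , _ , n₃) = n in
  Q s (base n) ≡ (n₃ * n₃ + s * n₃ * (s * n₃)) + 3# * (n₁ * n₁)
Q-base s (n₁ , n₂ , n₃) = solve 3 (λ s n₁ n₃ →
  Q s (- n₃ , 0# , n₁) ⊜ (n₃ * n₃ + s * n₃ * (s * n₃) + 3# * (n₁ * n₁))) refl s n₁ n₃

Φ-residue : ∀ (s : ℚ) (n : ℚ ³) (r : ℚ) → let (n₁ , n₂ , n₃) = n in
  r * r + 3# * (n₂ * n₂ + s * n₂ * (s * n₂))
    ≡ (r * r + Φ s n) + - κ s * n₁ * n₁ + - (1# + s * s) * (2# * n₂ + s * s * n₃) * n₃
Φ-residue s (n₁ , n₂ , n₃) r = solve 5 (λ s n₁ n₂ n₃ r →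
  r * r + 3# * (n₂ * n₂ + s * n₂ * (s * n₂))
    ⊜ ((r * r + Φ s (n₁ , n₂ , n₃))
       + - κ s * n₁ * n₁ + - (1# + s * s) * (2# * n₂ + s * s * n₃) * n₃))
  refl s n₁ n₂ n₃ r

base-off-conic : ∀ (s : ℚ) (n : ℚ ³) (r : ℚ) → r ≢ 0ℚ → r * r + Φ s n ≡ 0ℚ → Q s (base n) ≢ 0ℚ
base-off-conic s n@(n₁ , n₂ , n₃) r r≢0 disc Qbase≡0 = r≢0 (square-zero r²≡0)
  where
  squares≡0 : n₃ * n₃ + s * n₃ * (s * n₃) ≡ 0ℚ × 3# * (n₁ * n₁) ≡ 0ℚ
  squares≡0 = nonNeg+nonNeg≡0 (+-nonNeg (square-nonNeg n₃) (square-nonNeg (s * n₃)))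
                              (*-nonNeg 0≤3 (square-nonNeg n₁))
                              (trans (sym (Q-base s n)) Qbase≡0)
  n₁≡0 : n₁ ≡ 0ℚ
  n₁≡0 = square-zero ([ (λ ()) , id ]′ (zero-product 3# (n₁ * n₁) (proj₂ squares≡0)))
  n₃≡0 : n₃ ≡ 0ℚ
  n₃≡0 = square-zero
    (proj₁ (nonNeg+nonNeg≡0 (square-nonNeg n₃) (square-nonNeg (s * n₃)) (proj₁ squares≡0)))
  r²≡0 : r * r ≡ 0ℚ
  r²≡0 = proj₁ (nonNeg+nonNeg≡0
    (square-nonNeg r) (*-nonNeg 0≤3 (+-nonNeg (square-nonNeg n₂) (square-nonNeg (s * n₂))))
    (trans (Φ-residue s n r)
           (disc +⁰ *⁰ (- κ s * n₁) n₁≡0 +⁰ *⁰ (- (1# + s * s) * (2# * n₂ + s * s * n₃)) n₃≡0)))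

-- Two independent directions

module _ {R : Set} {{_ : Arithmetic R}} where

  -- coords (dir s g) = 2 ⋆ g, whatever s.
  coords : R ⁵ → R ³
  coords (β , ξ , η , μ , ν) = (ξ + μ , β + η + ν , η + ν)

  det₃ : R ³ → R ³ → R ³ → R
  det₃ (a₁ , a₂ , a₃) (c₁ , c₂ , c₃) (e₁ , e₂ , e₃) =
    a₁ * (c₂ * e₃ - c₃ * e₂) - a₂ * (c₁ * e₃ - c₃ * e₁) + a₃ * (c₁ * e₂ - c₂ * e₁)

  -- Chosen so that the determinant in det₃-pencil is a multiple of (Q s (base n))².
  weight : R → R ³ → R ³
  weight s (n₁ , n₂ , n₃) = (3# * n₁ , 0# , (1# + s * s) * n₃)

det₃-coords-• : ∀ (a : ℚ ³) (c : ℚ) (d : Pt) → det₃ a (coords ⌊ c • d ⌋) (coords ⌊ d ⌋) ≡ 0ℚ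
det₃-coords-• (a₁ , a₂ , a₃) c d = solve 9 (λ a₁ a₂ a₃ c β ξ η μ ν →
  det₃ (a₁ , a₂ , a₃) (coords (c * β , c * ξ , c * η , c * μ , c * ν)) (coords (β , ξ , η , μ , ν))
    ⊜ 0#)
  refl a₁ a₂ a₃ c (b d) (x d) (y d) (u d) (v d)

det₃-coords-zeroˡ : ∀ (a : ℚ ³) (d : Pt) → det₃ a (coords ⌊ zeroPt ⌋) (coords ⌊ d ⌋) ≡ 0ℚ
det₃-coords-zeroˡ (a₁ , a₂ , a₃) d = solve 8 (λ a₁ a₂ a₃ β ξ η μ ν →
  det₃ (a₁ , a₂ , a₃) (coords (0# , 0# , 0# , 0# , 0#)) (coords (β , ξ , η , μ , ν)) ⊜ 0#)
  refl a₁ a₂ a₃ (b d) (x d) (y d) (u d) (v d)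

det₃-coords-zeroʳ : ∀ (a : ℚ ³) (d : Pt) → det₃ a (coords ⌊ d ⌋) (coords ⌊ zeroPt ⌋) ≡ 0ℚ
det₃-coords-zeroʳ (a₁ , a₂ , a₃) d = solve 8 (λ a₁ a₂ a₃ β ξ η μ ν →
  det₃ (a₁ , a₂ , a₃) (coords (β , ξ , η , μ , ν)) (coords (0# , 0# , 0# , 0# , 0#)) ⊜ 0#)
  refl a₁ a₂ a₃ (b d) (x d) (y d) (u d) (v d)

module _ (a : ℚ ³) (d e : Pt) (det≢0 : det₃ a (coords ⌊ e ⌋) (coords ⌊ d ⌋) ≢ 0ℚ) where

  det₃≢0⇒e≢0 : ¬ e ≡ zeroPt
  det₃≢0⇒e≢0 refl = det≢0 (det₃-coords-zeroˡ a d)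

  det₃≢0⇒d≢0 : ¬ d ≡ zeroPt
  det₃≢0⇒d≢0 refl = det≢0 (det₃-coords-zeroʳ a e)

  det₃≢0⇒¬parallel : ¬ Parallel d e
  det₃≢0⇒¬parallel (c , refl) = det≢0 (det₃-coords-• a c d)

det₃-pencil : ∀ (s : ℚ) (n : ℚ ³) (r : ℚ) →
  det₃ (weight s n) (coords (dir s (pencil s n r (- 1#)))) (coords (dir s (pencil s n r 1#)))
    ≡ 8# * r * (Q s (base n) * Q s (base n))
det₃-pencil s (n₁ , n₂ , n₃) r = solve 5 (λ s n₁ n₂ n₃ r →
  det₃ (weight s (n₁ , n₂ , n₃)) (coords (dir s (pencil s (n₁ , n₂ , n₃) r (- 1#))))
                                 (coords (dir s (pencil s (n₁ , n₂ , n₃) r 1#)))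
    ⊜ 8# * r * (Q s (base (n₁ , n₂ , n₃)) * Q s (base (n₁ , n₂ , n₃)))) refl s n₁ n₂ n₃ r

det₃-pencil≢0 : ∀ (s : ℚ) (n : ℚ ³) (r : ℚ) → r ≢ 0ℚ → Q s (base n) ≢ 0ℚ →
  det₃ (weight s n) (coords (dir s (pencil s n r (- 1#)))) (coords (dir s (pencil s n r 1#))) ≢ 0ℚ
det₃-pencil≢0 s n r r≢0 Qbase≢0 det≡0 =
  *-nonZero (*-nonZero {8#} (λ ()) r≢0) (*-nonZero Qbase≢0 Qbase≢0)
            (trans (sym (det₃-pencil s n r)) det≡0)

slope : (p : Pt) → b p + y p + v p ≢ 0ℚ → ℚ
slope p D≢0 = (x p - u p) * (1/ (b p + y p + v p)) {{≢-nonZero D≢0}}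

Δ₁-slope : ∀ (p : Pt) (D≢0 : b p + y p + v p ≢ 0ℚ) → Δ₁ ⌊ p ⌋ (slope p D≢0) ≡ 0ℚ
Δ₁-slope p D≢0 = p≡q⇒p-q≡0 (begin
  (x p - u p) * 1/ D * D     ≡⟨ *-assoc (x p - u p) (1/ D) D ⟩
  (x p - u p) * (1/ D * D)   ≡⟨ cong ((x p - u p) *_) (*-inverseˡ D) ⟩
  (x p - u p) * 1ℚ           ≡⟨ *-identityʳ (x p - u p) ⟩
  x p - u p                  ∎)
  where
  open ≡-Reasoning
  D : ℚ
  D = b p + y p + v p
  instance
    D-nonZero : NonZero D
    D-nonZero = ≢-nonZero D≢0

Δ₂-via-Δ₁ : ∀ (p : Pt) (s : ℚ) →
  Δ₂ ⌊ p ⌋ s * (b p + y p + v p) ≡ (x p + u p + 1#) * Δ₁ ⌊ p ⌋ s + 1# * F₁ ⌊ p ⌋ + - 1# * F₂ ⌊ p ⌋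
Δ₂-via-Δ₁ p s = solve 6 (λ b x y u v s →
  Δ₂ (b , x , y , u , v) s * (b + y + v)
    ⊜ ((x + u + 1#) * Δ₁ (b , x , y , u , v) s
       + 1# * F₁ (b , x , y , u , v) + - 1# * F₂ (b , x , y , u , v)))
  refl (b p) (x p) (y p) (u p) (v p) s

Δ₂-vanishes : ∀ (p : Pt) (s : ℚ) →
  InV₂ p → Δ₁ ⌊ p ⌋ s ≡ 0ℚ → b p + y p + v p ≢ 0ℚ → Δ₂ ⌊ p ⌋ s ≡ 0ℚ
Δ₂-vanishes p s p∈V₂ δ₁ D≢0 = [ id , ⊥-elim ∘ D≢0 ]′ (zero-product (Δ₂ ⌊ p ⌋ s) (b p + y p + v p)
  (trans (Δ₂-via-Δ₁ p s) (*⁰ (x p + u p + 1#) δ₁ +⁰ *⁰ 1# (proj₁ f) +⁰ *⁰ (- 1#) (proj₂ f))))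
  where
  f : F₁ ⌊ p ⌋ ≡ 0ℚ × F₂ ⌊ p ⌋ ≡ 0ℚ
  f = InV₂⇒F≡0 p p∈V₂

κ≢0 : ∀ (s : ℚ) → κ s ≢ 0ℚ
κ≢0 s κ≡0 = √3∉ℚ (3# * s) (begin
  3# * s * (3# * s)      ≡⟨ solve 1 (λ s → 3# * s * (3# * s) ⊜ (3# + 3# * κ s)) refl s ⟩
  3# + 3# * κ s          ≡⟨ cong (λ e → 3# + 3# * e) κ≡0 ⟩
  3#                     ∎)
  where open ≡-Reasoning

module _ {R : Set} {{_ : Arithmetic R}} where

  cofactor₁ cofactor₂ : R ⁵ → R → R
  cofactor₁ p@(b , x , y , u , v) s =
    let (n₁ , n₂ , n₃) = normal p s
        m = 1# + s * s
        P = n₁ + m * (x + u + 1#) - 2#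
        T = 3# * n₂ + 3# * (s * s * (b + y + v) - (y + v)) + 2# * n₃
    in m * κ s * (2# * (x - u) + Δ₁ p s) - κ s * P - m * s * T
  cofactor₂ p@(b , x , y , u , v) s =
    let (n₁ , n₂ , n₃) = normal p s
        m = 1# + s * s
        P = n₁ + m * (x + u + 1#) - 2#
        T = 3# * n₂ + 3# * (s * s * (b + y + v) - (y + v)) + 2# * n₃
    in m * κ s * (2# * (v - y) + Δ₂ p s) - κ s * s * P + m * T

discriminant-identity : ∀ (p : Pt) (s : ℚ) →
  κ s * κ s + Φ s (normal ⌊ p ⌋ s)
    ≡ 2# * (1# + s * s) * κ s * F₁ ⌊ p ⌋ + 2# * (1# + s * s) * κ s * F₂ ⌊ p ⌋
      + cofactor₁ ⌊ p ⌋ s * Δ₁ ⌊ p ⌋ s + cofactor₂ ⌊ p ⌋ s * Δ₂ ⌊ p ⌋ s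
discriminant-identity p s = solve 6 (λ b x y u v s →
  κ s * κ s + Φ s (normal (b , x , y , u , v) s)
    ⊜ (2# * (1# + s * s) * κ s * F₁ (b , x , y , u , v)
       + 2# * (1# + s * s) * κ s * F₂ (b , x , y , u , v)
       + cofactor₁ (b , x , y , u , v) s * Δ₁ (b , x , y , u , v) s
       + cofactor₂ (b , x , y , u , v) s * Δ₂ (b , x , y , u , v) s))
  refl (b p) (x p) (y p) (u p) (v p) s

discriminant-square : ∀ (p : Pt) (s : ℚ) → InV₂ p → Δ₁ ⌊ p ⌋ s ≡ 0ℚ → Δ₂ ⌊ p ⌋ s ≡ 0ℚ →
  κ s * κ s + Φ s (normal ⌊ p ⌋ s) ≡ 0ℚ
discriminant-square p s p∈V₂ δ₁ δ₂ = trans (discriminant-identity p s)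
  (*⁰ (2# * (1# + s * s) * κ s) (proj₁ f) +⁰ *⁰ (2# * (1# + s * s) * κ s) (proj₂ f)
   +⁰ *⁰ (cofactor₁ ⌊ p ⌋ s) δ₁ +⁰ *⁰ (cofactor₂ ⌊ p ⌋ s) δ₂)
  where
  f : F₁ ⌊ p ⌋ ≡ 0ℚ × F₂ ⌊ p ⌋ ≡ 0ℚ
  f = InV₂⇒F≡0 p p∈V₂

x⁴-x-factors : ∀ (x : ℚ) → x * ((x - 1#) * (x * x + x + 1#)) ≡ x * x * (x * x) - x
x⁴-x-factors = solve 1 (λ x → x * ((x - 1#) * (x * x + x + 1#)) ⊜ (x * x * (x * x) - x)) refl

squaring-2-cycle : ∀ {x u : ℚ} → 0ℚ ≤ x → x * x ≡ u → u * u ≡ x →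
  (x ≡ 0ℚ × u ≡ 0ℚ) ⊎ (x ≡ 1ℚ × u ≡ 1ℚ)
squaring-2-cycle {x} 0≤x refl x⁴≡x =
  [ (λ x≡0 → inj₁ (x≡0 , cong (λ z → z * z) x≡0))
  , (λ e → [ (λ x-1≡0 → inj₂ (x≡1 x-1≡0 , cong (λ z → z * z) (x≡1 x-1≡0)))
           , (λ x²+x+1≡0 → ⊥-elim (nonNeg+1≢0 (+-nonNeg (square-nonNeg x) 0≤x) x²+x+1≡0))
           ]′ (zero-product (x - 1#) (x * x + x + 1#) e))
  ]′ (zero-product x ((x - 1#) * (x * x + x + 1#)) (trans (x⁴-x-factors x) (p≡q⇒p-q≡0 x⁴≡x)))
  where
  x≡1 : x - 1# ≡ 0ℚ → x ≡ 1ℚ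
  x≡1 = p-q≡0⇒p≡q

off-lines⇒b+y+v≢0 : ∀ {p} →
  InV₂ p → NonNeg p → ¬ OnLine₀ p → ¬ OnLine₁ p → b p + y p + v p ≢ 0ℚ
off-lines⇒b+y+v≢0 {pt b x y u v} (e₁ , e₂) (0≤b , 0≤x , 0≤y , 0≤u , 0≤v) ∉₀ ∉₁ D≡0 =
  on-axis b≡0 y≡0 v≡0 e₁ e₂
  where
  b+y≡0×v≡0 : b + y ≡ 0ℚ × v ≡ 0ℚ
  b+y≡0×v≡0 = nonNeg+nonNeg≡0 (+-nonNeg 0≤b 0≤y) 0≤v D≡0
  b≡0×y≡0 : b ≡ 0ℚ × y ≡ 0ℚ
  b≡0×y≡0 = nonNeg+nonNeg≡0 0≤b 0≤y (proj₁ b+y≡0×v≡0)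
  b≡0 : b ≡ 0ℚ
  b≡0 = proj₁ b≡0×y≡0
  y≡0 : y ≡ 0ℚ
  y≡0 = proj₂ b≡0×y≡0
  v≡0 : v ≡ 0ℚ
  v≡0 = proj₂ b+y≡0×v≡0
  on-axis : ∀ {b y v} → b ≡ 0ℚ → y ≡ 0ℚ → v ≡ 0ℚ →
            x * x + y * y ≡ u + b * v → u * u + v * v ≡ x + b * y → ⊥
  on-axis refl refl refl e₁ e₂
    with squaring-2-cycle 0≤x (trans (sym (+-identityʳ (x * x))) (trans e₁ (+-identityʳ u)))
                              (trans (sym (+-identityʳ (u * u))) (trans e₂ (+-identityʳ x)))
  ... | inj₁ (x≡0 , u≡0) = ∉₀ (x≡0 , y≡0 , u≡0 , v≡0)
  ... | inj₂ (x≡1 , u≡1) = ∉₁ (x≡1 , y≡0 , u≡1 , v≡0)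

proposition3p1 : (P : Pt) → InV₂ P → NonNeg P → ¬ OnLine₀ P → ¬ OnLine₁ P →
    ∃₂ λ (d₁ d₂ : Pt) → LineInV₂ P d₁ × LineInV₂ P d₂ × ¬ Parallel d₁ d₂
proposition3p1 P P∈V₂ P≥0 P∉ℓ₀ P∉ℓ₁ =
  d 1# , d (- 1#) ,
  (det₃≢0⇒d≢0 (weight s n) (d 1#) (d (- 1#)) det≢0 , line 1# refl) ,
  (det₃≢0⇒e≢0 (weight s n) (d 1#) (d (- 1#)) det≢0 , line (- 1#) refl) ,
  det₃≢0⇒¬parallel (weight s n) (d 1#) (d (- 1#)) det≢0
  where
  D≢0 : b P + y P + v P ≢ 0ℚ
  D≢0 = off-lines⇒b+y+v≢0 P∈V₂ P≥0 P∉ℓ₀ P∉ℓ₁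
  s : ℚ
  s = slope P D≢0
  n : ℚ ³
  n = normal ⌊ P ⌋ s
  d : ℚ → Pt
  d σ = ⌈ dir s (pencil s n (κ s) σ) ⌉
  δ₁ : Δ₁ ⌊ P ⌋ s ≡ 0ℚ
  δ₁ = Δ₁-slope P D≢0
  δ₂ : Δ₂ ⌊ P ⌋ s ≡ 0ℚ
  δ₂ = Δ₂-vanishes P s P∈V₂ δ₁ D≢0
  disc : κ s * κ s + Φ s n ≡ 0ℚ
  disc = discriminant-square P s P∈V₂ δ₁ δ₂
  line : ∀ σ → σ * σ ≡ 1ℚ → ∀ t → InV₂ (P +[ t ]• d σ)
  line σ σ²≡1 = dir-line⊆V₂ P s (pencil s n (κ s) σ) P∈V₂ δ₁ δ₂
                  (pencil-on-line s n (κ s) σ) (pencil-on-conic s n (κ s) σ disc σ²≡1)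
  det≢0 : det₃ (weight s n) (coords ⌊ d (- 1#) ⌋) (coords ⌊ d 1# ⌋) ≢ 0ℚ
  det≢0 = det₃-pencil≢0 s n (κ s) (κ≢0 s) (base-off-conic s n (κ s) (κ≢0 s) disc)
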